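{- Let $M$ be a matroid of rank $r$ on a finite set $E$ with rank function $\mathrm{rk}$, and let $x,y,\lambda,\xi$ be indeterminates. Then $$ \mathrm{R} (M;xy,\lambda \xi) = \sum_{T:\, T \subseteq E} \lambda^{r - \mathrm{rk} (T)} (-y)^{|T| - \mathrm{rk}(T)}\, \mathrm{R} (M|T;-x,-\lambda)\, \mathrm{R} (M/T;y,\xi). $$
   Context: For a matroid $N$ of rank $s$ on a set $F$ with rank function $\mathrm{rk}_N$, the nullity-corank (rank generating) polynomial is $\mathrm{R}(N;x,\lambda)=\sum_{A\subseteq F}x^{|A|-\mathrm{rk}_N(A)}\lambda^{s-\mathrm{rk}_N(A)}$. $M|T$ is the restriction of $M$ to $T$ (rank $\mathrm{rk}(T)$), and $M/T$ is the contraction, a matroid on $E\setminus T$ of rank $r-\mathrm{rk}(T)$ with rank function $A\mapsto \mathrm{rk}(A\cup T)-\mathrm{rk}(T)$. -}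

module Defs where

open import Level using (Level)
open import Data.Nat as ℕ using (ℕ; zero; suc; _∸_; _≤_)
open import Data.Bool using (true; false; if_then_else_)
open import Data.List using (List; []; _∷_; _++_; map; foldr)
open import Data.Vec using (Vec; []; _∷_)
open import Data.Fin.Subset using (Subset; _⊆_; _∪_; _∩_; ∁; ∣_∣; ⊤; inside; outside)
open import Data.Fin.Subset.Properties using (_⊆?_)
open import Relation.Nullary using (does)
open import Algebra.Bundles using (CommutativeRing)

allSubsets : ∀ n → List (Subset n)
allSubsets zero    = [] ∷ []
allSubsets (suc n) = map (outside ∷_) (allSubsets n) ++ map (inside ∷_) (allSubsets n)

record Matroid (n : ℕ) : Set where
  field
    rk          : Subset n → ℕ
    rk-bound    : ∀ A → rk A ≤ ∣ A ∣
    rk-mono     : ∀ {A B} → A ⊆ B → rk A ≤ rk B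
    rk-submod   : ∀ A B → rk (A ∪ B) ℕ.+ rk (A ∩ B) ≤ rk A ℕ.+ rk B

  rank : ℕ
  rank = rk ⊤

-- a matroid whose ground set F is a subset of Fin n, described by its
-- ground set, its rank function (only evaluated on subsets of F) and its rank s
record SubMatroidData (n : ℕ) : Set where
  field
    ground : Subset n
    rkN    : Subset n → ℕ
    rankN  : ℕ

open SubMatroidData

whole : ∀ {n} → Matroid n → SubMatroidData n
whole M = record { ground = ⊤ ; rkN = Matroid.rk M ; rankN = Matroid.rank M }

restrict : ∀ {n} → Matroid n → Subset n → SubMatroidData n
restrict M T = record { ground = T ; rkN = Matroid.rk M ; rankN = Matroid.rk M T }

contract : ∀ {n} → Matroid n → Subset n → SubMatroidData n
contract M T = record
  { ground = ∁ T
  ; rkN    = λ A → Matroid.rk M (A ∪ T) ∸ Matroid.rk M T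
  ; rankN  = Matroid.rank M ∸ Matroid.rk M T }

module _ {c ℓ : Level} (R : CommutativeRing c ℓ) where
  open CommutativeRing R

  pow : Carrier → ℕ → Carrier
  pow a zero    = 1#
  pow a (suc k) = a * pow a k

  sumSub : ∀ {n} → Subset n → (Subset n → Carrier) → Carrier
  sumSub {n} S f = foldr (λ A acc → (if does (A ⊆? S) then f A else 0#) + acc) 0# (allSubsets n)

  Rpoly : ∀ {n} → SubMatroidData n → Carrier → Carrier → Carrier
  Rpoly N x l = sumSub (ground N) λ A →
    pow x (∣ A ∣ ∸ rkN N A) * pow l (rankN N ∸ rkN N A)

module Submission where

-- Expand both Tutte-type polynomials on the right.  The summand of R(M|T) is
-- indexed by A ⊆ T, that of R(M/T) by B ⊆ E∖T, and we re-index B by C = B ∪ T,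
-- so C ranges over the supersets of T.  Because nullities and coranks of M|T
-- and M/T telescope (rk(B ∪ T) − rk T ≤ |B| by submodularity), each product
-- collapses to the single monomial (−1)^{|T|} (−1)^{|A|} m(A, C) with
--   m(A, C) = x^{|A|−rk A} λ^{r−rk A} y^{|C|−rk C} ξ^{r−rk C}.
-- Exchanging the sums over T and A leaves Σ_A Σ_{A ⊆ T} (−1)^{|T|} Σ_{T ⊆ C} h(C),
-- which by Möbius inversion on the Boolean lattice equals Σ_A (−1)^{|A|} h(A);
-- only the diagonal C = A survives, and it is the summand of R(M; xy, λξ).

open import Defs
open import Level using (Level)
open import Data.Nat using (ℕ; _∸_)
open import Data.Fin.Subset using (∣_∣; ⊤)
open import Algebra.Bundles using (CommutativeRing)

open import Data.Nat as Nat using (zero; suc; _≤_)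
import Data.Nat.Properties as NatP
open import Data.Bool using (if_then_else_)
open import Data.List using (List; []; _∷_; _++_; map; foldr)
open import Data.Vec using ([]; _∷_)
open import Data.Fin.Subset using (Subset; _⊆_; _∪_; _∩_; _─_; ∁; inside; outside)
open import Data.Fin.Subset.Properties using (_⊆?_; ⊆⊤; drop-∷-⊆)
open import Relation.Nullary using (Dec; does; yes; no; contradiction)
open import Relation.Unary using (Pred; Decidable)
import Relation.Binary.PropositionalEquality as ≡
open ≡ using (_≡_)

-- Arithmetic of the exponents, all natural numbers with truncated subtraction.
module Exponents where
  open Nat using (_+_)
  open NatP using (+-comm; +-∸-assoc; +-∸-comm; ∸-+-assoc; m+[n∸m]≡n; m∸n+n≡m; m≤n+o⇒m∸n≤o)
  open ≡.≡-Reasoning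

  ∸-telescope : ∀ {m n o} → o ≤ n → n ≤ m → (n ∸ o) + (m ∸ n) ≡ m ∸ o
  ∸-telescope {m} {n} {o} o≤n n≤m = begin
    (n ∸ o) + (m ∸ n)   ≡⟨ +-comm (n ∸ o) (m ∸ n) ⟩
    (m ∸ n) + (n ∸ o)   ≡⟨ ≡.sym (+-∸-assoc (m ∸ n) o≤n) ⟩
    (m ∸ n) + n ∸ o     ≡⟨ ≡.cong (_∸ o) (m∸n+n≡m n≤m) ⟩
    m ∸ o               ∎

  -- Subtracting o from both terms of a difference changes nothing.
  -- This is the corank of M/T: (r − rk T) − (rk C − rk T) = r − rk C.
  ∸-∸-cancel : ∀ m {n o} → o ≤ n → (m ∸ o) ∸ (n ∸ o) ≡ m ∸ n
  ∸-∸-cancel m {n} {o} o≤n = ≡.trans (∸-+-assoc m o (n ∸ o)) (≡.cong (m ∸_) (m+[n∸m]≡n o≤n))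

  -- Nullities add along T ⊆ C: if |B| = |C ∖ T| and rk C ≤ |B| + rk T, then
  -- (|T| − rk T) + (|B| − (rk C − rk T)) = |C| − rk C.
  nullity-split : ∀ {t o n b} → o ≤ t → o ≤ n → n ≤ b + o →
    (t ∸ o) + (b ∸ (n ∸ o)) ≡ (b + t) ∸ n
  nullity-split {t} {o} {n} {b} o≤t o≤n n≤b+o = begin
    (t ∸ o) + (b ∸ d)   ≡⟨ +-comm (t ∸ o) (b ∸ d) ⟩
    (b ∸ d) + (t ∸ o)   ≡⟨ ≡.sym (+-∸-assoc (b ∸ d) o≤t) ⟩
    (b ∸ d) + t ∸ o     ≡⟨ ≡.cong (_∸ o) (≡.sym (+-∸-comm t d≤b)) ⟩
    (b + t) ∸ d ∸ o     ≡⟨ ∸-+-assoc (b + t) d o ⟩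
    (b + t) ∸ (d + o)   ≡⟨ ≡.cong ((b + t) ∸_) (m∸n+n≡m o≤n) ⟩
    (b + t) ∸ n         ∎
    where
    d : ℕ
    d = n ∸ o
    d≤b : d ≤ b
    d≤b = m≤n+o⇒m∸n≤o n o (≡.subst (n ≤_) (+-comm b o) n≤b+o)

module SubsetDifference where
  open import Data.Vec using (here)

  not-inside⊆outside : ∀ {n} {T C : Subset n} → inside ∷ T ⊆ outside ∷ C → ∀ {a} {A : Set a} → A
  not-inside⊆outside T⊆C with T⊆C here
  ... | ()

  ─-∪-cancel : ∀ {n} (C T : Subset n) → T ⊆ C → (C ─ T) ∪ T ≡ C
  ─-∪-cancel []            []            _   = ≡.refl
  ─-∪-cancel (outside ∷ C) (outside ∷ T) T⊆C = ≡.cong (outside ∷_) (─-∪-cancel C T (drop-∷-⊆ T⊆C))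
  ─-∪-cancel (inside ∷ C)  (outside ∷ T) T⊆C = ≡.cong (inside ∷_) (─-∪-cancel C T (drop-∷-⊆ T⊆C))
  ─-∪-cancel (inside ∷ C)  (inside ∷ T)  T⊆C = ≡.cong (inside ∷_) (─-∪-cancel C T (drop-∷-⊆ T⊆C))
  ─-∪-cancel (outside ∷ C) (inside ∷ T)  T⊆C = not-inside⊆outside T⊆C

  ∣─∣+∣∣ : ∀ {n} (C T : Subset n) → T ⊆ C → ∣ C ─ T ∣ Nat.+ ∣ T ∣ ≡ ∣ C ∣
  ∣─∣+∣∣ []            []            _   = ≡.refl
  ∣─∣+∣∣ (outside ∷ C) (outside ∷ T) T⊆C = ∣─∣+∣∣ C T (drop-∷-⊆ T⊆C)
  ∣─∣+∣∣ (inside ∷ C)  (outside ∷ T) T⊆C = ≡.cong suc (∣─∣+∣∣ C T (drop-∷-⊆ T⊆C))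
  ∣─∣+∣∣ (inside ∷ C)  (inside ∷ T)  T⊆C =
    ≡.trans (NatP.+-suc ∣ C ─ T ∣ ∣ T ∣) (≡.cong suc (∣─∣+∣∣ C T (drop-∷-⊆ T⊆C)))
  ∣─∣+∣∣ (outside ∷ C) (inside ∷ T)  T⊆C = not-inside⊆outside T⊆C

module OverRing {c ℓ : Level} (R : CommutativeRing c ℓ) where
  open CommutativeRing R hiding (zero)
  open import Relation.Binary.Reasoning.Setoid setoid
  open import Algebra.Properties.Ring ring using (-1*x≈-x; -‿involutive)
  open import Algebra.Properties.CommutativeSemigroup *-commutativeSemigroup using (interchange)
  open Exponents

  infixr 8 _^_
  _^_ : Carrier → ℕ → Carrier
  z ^ k = pow R z k

  ^-+ : ∀ z m k → z ^ (m Nat.+ k) ≈ z ^ m * z ^ k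
  ^-+ z zero    k = sym (*-identityˡ _)
  ^-+ z (suc m) k = trans (*-congˡ (^-+ z m k)) (sym (*-assoc _ _ _))

  ^-combine : ∀ z i j {k} → i Nat.+ j ≡ k → z ^ i * z ^ j ≈ z ^ k
  ^-combine z i j ≡.refl = sym (^-+ z i j)

  ^-distrib-* : ∀ a b k → (a * b) ^ k ≈ a ^ k * b ^ k
  ^-distrib-* a b zero    = sym (*-identityˡ _)
  ^-distrib-* a b (suc k) = trans (*-congˡ (^-distrib-* a b k)) (interchange a b _ _)

  sgn : ℕ → Carrier
  sgn k = (- 1#) ^ k

  -1*-1≈1 : - 1# * - 1# ≈ 1#
  -1*-1≈1 = trans (-1*x≈-x (- 1#)) (-‿involutive 1#)

  sgn-sq : ∀ k → sgn k * sgn k ≈ 1#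
  sgn-sq zero    = *-identityˡ _
  sgn-sq (suc k) = begin
    (- 1# * sgn k) * (- 1# * sgn k)   ≈⟨ interchange _ _ _ _ ⟩
    (- 1# * - 1#) * (sgn k * sgn k)   ≈⟨ *-cong -1*-1≈1 (sgn-sq k) ⟩
    1# * 1#                           ≈⟨ *-identityˡ _ ⟩
    1#                                ∎

  sgn-sq-cancel : ∀ k z → (sgn k * sgn k) * z ≈ z
  sgn-sq-cancel k z = trans (*-congʳ (sgn-sq k)) (*-identityˡ z)

  -- (−1)^{m−n} = (−1)^m (−1)^n for n ≤ m, because (−1)^{2n} = 1.
  sgn-∸ : ∀ {m n} → n ≤ m → sgn (m ∸ n) ≈ sgn m * sgn n
  sgn-∸ {m} {n} n≤m = begin
    sgn (m ∸ n)                     ≈⟨ sym (*-identityʳ _) ⟩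
    sgn (m ∸ n) * 1#                ≈⟨ *-congˡ (sym (sgn-sq n)) ⟩
    sgn (m ∸ n) * (sgn n * sgn n)   ≈⟨ sym (*-assoc _ _ _) ⟩
    sgn (m ∸ n) * sgn n * sgn n     ≈⟨ *-congʳ (^-combine (- 1#) (m ∸ n) n (NatP.m∸n+n≡m n≤m)) ⟩
    sgn m * sgn n                   ∎

  ^-neg : ∀ z k → (- z) ^ k ≈ sgn k * z ^ k
  ^-neg z zero    = sym (*-identityˡ _)
  ^-neg z (suc k) = begin
    - z * (- z) ^ k                 ≈⟨ *-cong (sym (-1*x≈-x z)) (^-neg z k) ⟩
    (- 1# * z) * (sgn k * z ^ k)    ≈⟨ interchange _ _ _ _ ⟩
    (- 1# * sgn k) * (z * z ^ k)    ∎

  ^-neg-∸ : ∀ z {m n} → n ≤ m → (- z) ^ (m ∸ n) ≈ (sgn m * sgn n) * z ^ (m ∸ n)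
  ^-neg-∸ z {m} {n} n≤m = trans (^-neg z (m ∸ n)) (*-congʳ (sgn-∸ n≤m))

  -- In the application
  -- a = |A|, t = |T|, b = |C ∖ T| and rA, rT, rC, r are the ranks of A ⊆ T ⊆ C ⊆ E;
  -- the left side is the product of the weight of T, the summand of R(M|T; −x, −λ)
  -- at A and the summand of R(M/T; y, ξ) at C ∖ T.

  monomial-identity : ∀ x y l ξ {a rA t rT b rC r} →
    rA ≤ a → rA ≤ rT → rT ≤ t → rT ≤ rC → rC ≤ r → rC ≤ b Nat.+ rT →
    l ^ (r ∸ rT) * (- y) ^ (t ∸ rT) * ((- x) ^ (a ∸ rA) * (- l) ^ (rT ∸ rA))
      * (y ^ (b ∸ (rC ∸ rT)) * ξ ^ ((r ∸ rT) ∸ (rC ∸ rT)))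
    ≈ sgn t * (sgn a * (x ^ (a ∸ rA) * l ^ (r ∸ rA) * y ^ ((b Nat.+ t) ∸ rC) * ξ ^ (r ∸ rC)))
  monomial-identity x y l ξ {a} {rA} {t} {rT} {b} {rC} {r} rA≤a rA≤rT rT≤t rT≤rC rC≤r rC≤b+rT =
    begin
      Lr * (- y) ^ (t ∸ rT) * ((- x) ^ (a ∸ rA) * (- l) ^ (rT ∸ rA)) * (Yb * Ξ)
    ≈⟨ *-congʳ (*-cong (*-congˡ (^-neg-∸ y rT≤t))
                       (*-cong (^-neg-∸ x rA≤a) (^-neg-∸ l rA≤rT))) ⟩
      Lr * (sT * sRT * Yt) * (sA * sRA * X * (sRT * sRA * Ll)) * (Yb * Ξ)
    ≈⟨ rearrange ⟩
      (sRT * sRT) * ((sRA * sRA) * (sT * (sA * (X * (Ll * Lr) * (Yt * Yb) * Ξ))))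
    ≈⟨ trans (sgn-sq-cancel rT _) (sgn-sq-cancel rA _) ⟩
      sT * (sA * (X * (Ll * Lr) * (Yt * Yb) * Ξ))
    ≈⟨ *-congˡ (*-congˡ (*-cong (*-cong (*-congˡ l-exponent) y-exponent) ξ-exponent)) ⟩
      sgn t * (sgn a * (X * l ^ (r ∸ rA) * y ^ ((b Nat.+ t) ∸ rC) * ξ ^ (r ∸ rC)))
    ∎
    where
    open import Algebra.Solver.CommutativeMonoid *-commutativeMonoid using (solve; _⊕_; _⊜_)
    sT sA sRT sRA X Lr Ll Yt Yb Ξ : Carrier
    sT = sgn t ; sA = sgn a ; sRT = sgn rT ; sRA = sgn rA
    X = x ^ (a ∸ rA) ; Lr = l ^ (r ∸ rT) ; Ll = l ^ (rT ∸ rA)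
    Yt = y ^ (t ∸ rT) ; Yb = y ^ (b ∸ (rC ∸ rT)) ; Ξ = ξ ^ ((r ∸ rT) ∸ (rC ∸ rT))

    rearrange : Lr * (sT * sRT * Yt) * (sA * sRA * X * (sRT * sRA * Ll)) * (Yb * Ξ)
      ≈ (sRT * sRT) * ((sRA * sRA) * (sT * (sA * (X * (Ll * Lr) * (Yt * Yb) * Ξ))))
    rearrange = solve 10 (λ sT sA sRT sRA X Ll Lr Yt Yb Ξ →
      ((Lr ⊕ ((sT ⊕ sRT) ⊕ Yt)) ⊕ (((sA ⊕ sRA) ⊕ X) ⊕ ((sRT ⊕ sRA) ⊕ Ll))) ⊕ (Yb ⊕ Ξ)
      ⊜ (sRT ⊕ sRT) ⊕ ((sRA ⊕ sRA) ⊕ (sT ⊕ (sA ⊕ (((X ⊕ (Ll ⊕ Lr)) ⊕ (Yt ⊕ Yb)) ⊕ Ξ)))))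
      refl sT sA sRT sRA X Ll Lr Yt Yb Ξ

    l-exponent : Ll * Lr ≈ l ^ (r ∸ rA)
    l-exponent = ^-combine l (rT ∸ rA) (r ∸ rT) (∸-telescope rA≤rT (NatP.≤-trans rT≤rC rC≤r))

    y-exponent : Yt * Yb ≈ y ^ ((b Nat.+ t) ∸ rC)
    y-exponent = ^-combine y (t ∸ rT) (b ∸ (rC ∸ rT)) (nullity-split rT≤t rT≤rC rC≤b+rT)

    ξ-exponent : Ξ ≈ ξ ^ (r ∸ rC)
    ξ-exponent = reflexive (≡.cong (ξ ^_) (∸-∸-cancel r rT≤rC))

  -- Finite sums over a list.  `sumSub` of Defs is such a sum over the list of all
  -- subsets, with the summands outside the range replaced by 0.
  sumL : {X : Set} → List X → (X → Carrier) → Carrier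
  sumL xs f = foldr (λ a acc → f a + acc) 0# xs

  sumL-cong : {X : Set} (xs : List X) {f g : X → Carrier} → (∀ a → f a ≈ g a) → sumL xs f ≈ sumL xs g
  sumL-cong []       f≈g = refl
  sumL-cong (a ∷ xs) f≈g = +-cong (f≈g a) (sumL-cong xs f≈g)

  sumL-0 : {X : Set} (xs : List X) → sumL xs (λ _ → 0#) ≈ 0#
  sumL-0 []       = refl
  sumL-0 (a ∷ xs) = trans (+-identityˡ _) (sumL-0 xs)

  sumL-+ : {X : Set} (xs : List X) (f g : X → Carrier) → sumL xs (λ a → f a + g a) ≈ sumL xs f + sumL xs g
  sumL-+ []       f g = sym (+-identityˡ _)
  sumL-+ (a ∷ xs) f g = trans (+-congˡ (sumL-+ xs f g)) (+-interchange (f a) (g a) _ _)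
    where open import Algebra.Properties.CommutativeSemigroup +-commutativeSemigroup
            using () renaming (interchange to +-interchange)

  sumL-*ˡ : {X : Set} (xs : List X) (k : Carrier) (f : X → Carrier) → k * sumL xs f ≈ sumL xs (λ a → k * f a)
  sumL-*ˡ []       k f = zeroʳ k
  sumL-*ˡ (a ∷ xs) k f = trans (distribˡ k _ _) (+-congˡ (sumL-*ˡ xs k f))

  sumL-*ʳ : {X : Set} (xs : List X) (k : Carrier) (f : X → Carrier) → sumL xs f * k ≈ sumL xs (λ a → f a * k)
  sumL-*ʳ xs k f = trans (*-comm _ k) (trans (sumL-*ˡ xs k f) (sumL-cong xs (λ a → *-comm k (f a))))

  sumL-++ : {X : Set} (xs ys : List X) (f : X → Carrier) → sumL (xs ++ ys) f ≈ sumL xs f + sumL ys f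
  sumL-++ []       ys f = sym (+-identityˡ _)
  sumL-++ (a ∷ xs) ys f = trans (+-congˡ (sumL-++ xs ys f)) (sym (+-assoc _ _ _))

  sumL-map : {X Y : Set} (h : X → Y) (xs : List X) (f : Y → Carrier) → sumL (map h xs) f ≡ sumL xs (λ a → f (h a))
  sumL-map h []       f = ≡.refl
  sumL-map h (a ∷ xs) f = ≡.cong (f (h a) +_) (sumL-map h xs f)

  sumL-swap : {X Y : Set} (xs : List X) (ys : List Y) (f : X → Y → Carrier) →
    sumL xs (λ a → sumL ys (f a)) ≈ sumL ys (λ b → sumL xs (λ a → f a b))
  sumL-swap []       ys f = sym (sumL-0 ys)
  sumL-swap (a ∷ xs) ys f = trans (+-congˡ (sumL-swap xs ys f)) (sym (sumL-+ ys (f a) _))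

  guard : ∀ {p} {P : Set p} → Dec P → Carrier → Carrier
  guard d v = if does d then v else 0#

  guard-cong : ∀ {p} {P : Set p} (d : Dec P) {u v : Carrier} → (P → u ≈ v) → guard d u ≈ guard d v
  guard-cong (yes p) u≈v = u≈v p
  guard-cong (no _)  u≈v = refl

  guard-yes : ∀ {p} {P : Set p} (d : Dec P) {v : Carrier} → P → guard d v ≈ v
  guard-yes (yes _) p = refl
  guard-yes (no ¬p) p = contradiction p ¬p

  guard-+ : ∀ {p} {P : Set p} (d : Dec P) (u v : Carrier) → guard d (u + v) ≈ guard d u + guard d v
  guard-+ (yes _) u v = refl
  guard-+ (no _)  u v = sym (+-identityˡ 0#)

  guard-*ˡ : ∀ {p} {P : Set p} (d : Dec P) (k v : Carrier) → k * guard d v ≈ guard d (k * v)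
  guard-*ˡ (yes _) k v = refl
  guard-*ˡ (no _)  k v = zeroʳ k

  guard-*ʳ : ∀ {p} {P : Set p} (d : Dec P) (k v : Carrier) → guard d v * k ≈ guard d (v * k)
  guard-*ʳ (yes _) k v = refl
  guard-*ʳ (no _)  k v = zeroˡ k

  -- The sums over
  -- subsets of S are `sumSub R S` from Defs, which unfolds to `sumWhere (_⊆? S)`.
  sumAll : ∀ {n} → (Subset n → Carrier) → Carrier
  sumAll {n} = sumL (allSubsets n)

  sumWhere : ∀ {n p} {P : Pred (Subset n) p} → Decidable P → (Subset n → Carrier) → Carrier
  sumWhere P? f = sumAll (λ X → guard (P? X) (f X))

  sumSup : ∀ {n} → Subset n → (Subset n → Carrier) → Carrier
  sumSup A f = sumWhere (A ⊆?_) f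

  sumAll-cong : ∀ {n} {f g : Subset n → Carrier} → (∀ X → f X ≈ g X) → sumAll f ≈ sumAll g
  sumAll-cong {n} = sumL-cong (allSubsets n)

  sumWhere-cong : ∀ {n p} {P : Pred (Subset n) p} (P? : Decidable P) {f g : Subset n → Carrier} →
    (∀ X → P X → f X ≈ g X) → sumWhere P? f ≈ sumWhere P? g
  sumWhere-cong P? f≈g = sumAll-cong (λ X → guard-cong (P? X) (f≈g X))

  sumWhere-+ : ∀ {n p} {P : Pred (Subset n) p} (P? : Decidable P) (f g : Subset n → Carrier) →
    sumWhere P? (λ X → f X + g X) ≈ sumWhere P? f + sumWhere P? g
  sumWhere-+ {n} P? f g = trans (sumAll-cong (λ X → guard-+ (P? X) _ _)) (sumL-+ (allSubsets n) _ _)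

  sumWhere-*ˡ : ∀ {n p} {P : Pred (Subset n) p} (P? : Decidable P) (k : Carrier) (f : Subset n → Carrier) →
    k * sumWhere P? f ≈ sumWhere P? (λ X → k * f X)
  sumWhere-*ˡ {n} P? k f = trans (sumL-*ˡ (allSubsets n) k _) (sumAll-cong (λ X → guard-*ˡ (P? X) k _))

  sumWhere-product : ∀ {n p q} {P : Pred (Subset n) p} {Q : Pred (Subset n) q}
    (P? : Decidable P) (Q? : Decidable Q) (f g : Subset n → Carrier) →
    sumWhere P? f * sumWhere Q? g ≈ sumWhere P? (λ X → sumWhere Q? (λ Y → f X * g Y))
  sumWhere-product {n} P? Q? f g = trans (sumL-*ʳ (allSubsets n) _ _) (sumAll-cong (λ X →
    trans (guard-*ʳ (P? X) _ _) (guard-cong (P? X) (λ _ → sumWhere-*ˡ Q? (f X) g))))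

  sumWhere-all : ∀ {n p} {P : Pred (Subset n) p} (P? : Decidable P) (f : Subset n → Carrier) →
    (∀ X → P X) → sumWhere P? f ≈ sumAll f
  sumWhere-all P? f all = sumAll-cong (λ X → guard-yes (P? X) (all X))

  sumSub-sumSup-swap : ∀ {n} (F : Subset n → Subset n → Carrier) →
    sumAll (λ T → sumSub R T (λ A → F A T)) ≈ sumAll (λ A → sumSup A (λ T → F A T))
  sumSub-sumSup-swap {n} F = sumL-swap (allSubsets n) (allSubsets n) _

  sumAll-cons : ∀ {n} (f : Subset (suc n) → Carrier) →
    sumAll f ≈ sumAll (λ X → f (outside ∷ X)) + sumAll (λ X → f (inside ∷ X))
  sumAll-cons {n} f = trans (sumL-++ (map (outside ∷_) (allSubsets n)) _ f)
    (reflexive (≡.cong₂ _+_ (sumL-map (outside ∷_) (allSubsets n) f) (sumL-map (inside ∷_) (allSubsets n) f)))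

  +-zero-sum : ∀ {n} (u : Carrier) → u + sumAll {n} (λ _ → 0#) ≈ u
  +-zero-sum {n} u = trans (+-congˡ (sumL-0 (allSubsets n))) (+-identityʳ u)

  sumSup-outside : ∀ {n} (A : Subset n) (f : Subset (suc n) → Carrier) →
    sumSup (outside ∷ A) f ≈ sumSup A (λ T → f (outside ∷ T)) + sumSup A (λ T → f (inside ∷ T))
  sumSup-outside A f = sumAll-cons (λ T → guard (outside ∷ A ⊆? T) (f T))

  sumSup-inside : ∀ {n} (A : Subset n) (f : Subset (suc n) → Carrier) →
    sumSup (inside ∷ A) f ≈ sumSup A (λ T → f (inside ∷ T))
  sumSup-inside {n} A f = trans (sumAll-cons (λ T → guard (inside ∷ A ⊆? T) (f T))) (trans (+-comm _ _) (+-zero-sum {n} _))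

  sumSub-outside : ∀ {n} (S : Subset n) (f : Subset (suc n) → Carrier) →
    sumSub R (outside ∷ S) f ≈ sumSub R S (λ B → f (outside ∷ B))
  sumSub-outside {n} S f = trans (sumAll-cons (λ B → guard (B ⊆? outside ∷ S) (f B))) (+-zero-sum {n} _)

  sumSub-inside : ∀ {n} (S : Subset n) (f : Subset (suc n) → Carrier) →
    sumSub R (inside ∷ S) f ≈ sumSub R S (λ B → f (outside ∷ B)) + sumSub R S (λ B → f (inside ∷ B))
  sumSub-inside S f = sumAll-cons (λ B → guard (B ⊆? inside ∷ S) (f B))

  sumSub-complement : ∀ {n} (T : Subset n) (f : Subset n → Carrier) →
    sumSub R (∁ T) f ≈ sumSup T (λ C → f (C ─ T))
  sumSub-complement []            f = refl
  sumSub-complement (outside ∷ T) f = begin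
    sumSub R (inside ∷ ∁ T) f
      ≈⟨ sumSub-inside (∁ T) f ⟩
    sumSub R (∁ T) (λ B → f (outside ∷ B)) + sumSub R (∁ T) (λ B → f (inside ∷ B))
      ≈⟨ +-cong (sumSub-complement T _) (sumSub-complement T _) ⟩
    sumSup T (λ C → f (outside ∷ (C ─ T))) + sumSup T (λ C → f (inside ∷ (C ─ T)))
      ≈⟨ sym (sumSup-outside T _) ⟩
    sumSup (outside ∷ T) (λ C → f (C ─ (outside ∷ T)))
      ∎
  sumSub-complement (inside ∷ T) f = begin
    sumSub R (outside ∷ ∁ T) f                   ≈⟨ sumSub-outside (∁ T) f ⟩
    sumSub R (∁ T) (λ B → f (outside ∷ B))       ≈⟨ sumSub-complement T _ ⟩
    sumSup T (λ C → f (outside ∷ (C ─ T)))       ≈⟨ sym (sumSup-inside T _) ⟩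
    sumSup (inside ∷ T) (λ C → f (C ─ (inside ∷ T))) ∎

  sg : ∀ {n} → Subset n → Carrier
  sg T = sgn ∣ T ∣

  u-u≈0 : ∀ u → u + - 1# * u ≈ 0#
  u-u≈0 u = trans (+-congˡ (-1*x≈-x u)) (-‿inverseʳ u)

  -- Induction on n, splitting
  -- off the first coordinate: if it lies outside A, the terms with it in T cancel
  -- those with it outside T whenever it lies in C.
  mobius : ∀ {n} (A : Subset n) (h : Subset n → Carrier) →
    sumSup A (λ T → sg T * sumSup T h) ≈ sg A * h A
  mobius []            h = trans (+-identityʳ _) (*-congˡ (+-identityʳ _))
  mobius {suc n} (outside ∷ A) h = begin
    sumSup (outside ∷ A) (λ T → sg T * sumSup T h)
      ≈⟨ sumSup-outside A _ ⟩
    sumSup A (λ T → sg T * sumSup (outside ∷ T) h) + sumSup A (λ T → (- 1# * sg T) * sumSup (inside ∷ T) h)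
      ≈⟨ +-cong (sumWhere-cong (A ⊆?_) (λ T _ → *-congˡ (sumSup-outside T h)))
                (sumWhere-cong (A ⊆?_) (λ T _ → trans (*-congˡ (sumSup-inside T h)) (*-assoc _ _ _))) ⟩
    sumSup A (λ T → sg T * (sumSup T h₀ + sumSup T h₁)) + sumSup A (λ T → - 1# * (sg T * sumSup T h₁))
      ≈⟨ +-cong (trans (sumWhere-cong (A ⊆?_) (λ T _ → distribˡ _ _ _)) (sumWhere-+ (A ⊆?_) _ _))
                (sym (sumWhere-*ˡ (A ⊆?_) (- 1#) _)) ⟩
    (sumSup A (λ T → sg T * sumSup T h₀) + Σ₁) + - 1# * Σ₁
      ≈⟨ trans (+-assoc _ _ _) (trans (+-congˡ (u-u≈0 Σ₁)) (+-identityʳ _)) ⟩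
    sumSup A (λ T → sg T * sumSup T h₀)
      ≈⟨ mobius A h₀ ⟩
    sg A * h (outside ∷ A) ∎
    where
    h₀ h₁ : Subset n → Carrier
    h₀ C = h (outside ∷ C)
    h₁ C = h (inside ∷ C)
    Σ₁ : Carrier
    Σ₁ = sumSup A (λ T → sg T * sumSup T h₁)
  mobius {suc n} (inside ∷ A) h = begin
    sumSup (inside ∷ A) (λ T → sg T * sumSup T h)
      ≈⟨ sumSup-inside A _ ⟩
    sumSup A (λ T → (- 1# * sg T) * sumSup (inside ∷ T) h)
      ≈⟨ sumWhere-cong (A ⊆?_) (λ T _ → trans (*-congˡ (sumSup-inside T h)) (*-assoc _ _ _)) ⟩
    sumSup A (λ T → - 1# * (sg T * sumSup T h₁))
      ≈⟨ sym (sumWhere-*ˡ (A ⊆?_) (- 1#) _) ⟩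
    - 1# * sumSup A (λ T → sg T * sumSup T h₁)
      ≈⟨ *-congˡ (mobius A h₁) ⟩
    - 1# * (sg A * h (inside ∷ A))
      ≈⟨ sym (*-assoc _ _ _) ⟩
    sg (inside ∷ A) * h (inside ∷ A) ∎
    where
    h₁ : Subset n → Carrier
    h₁ C = h (inside ∷ C)

module Convolution {c ℓ : Level} (R : CommutativeRing c ℓ) {n : ℕ} (M : Matroid n)
                   (x y l ξ : CommutativeRing.Carrier R) where
  open CommutativeRing R hiding (zero)
  open import Relation.Binary.Reasoning.Setoid setoid
  open import Algebra.Properties.CommutativeSemigroup *-commutativeSemigroup using (interchange)
  open import Data.Fin.Subset.Properties using (q⊆p∪q)
  open OverRing R
  open SubsetDifference
  open Matroid M

  r : ℕ
  r = rank

  -- rk(B ∪ T) − rk T ≤ |B|: ranks in the contraction M/T are bounded by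
  -- cardinalities.  This is where submodularity enters.
  rk-∪-≤ : ∀ B T → rk (B ∪ T) ≤ ∣ B ∣ Nat.+ rk T
  rk-∪-≤ B T = NatP.≤-trans (NatP.m≤m+n (rk (B ∪ T)) (rk (B ∩ T)))
                 (NatP.≤-trans (rk-submod B T) (NatP.+-monoˡ-≤ (rk T) (rk-bound B)))

  weight : Subset n → Carrier
  weight T = l ^ (r ∸ rk T) * (- y) ^ (∣ T ∣ ∸ rk T)

  restrictTerm : Subset n → Subset n → Carrier
  restrictTerm T A = (- x) ^ (∣ A ∣ ∸ rk A) * (- l) ^ (rk T ∸ rk A)

  contractTerm : Subset n → Subset n → Carrier
  contractTerm T B = y ^ (∣ B ∣ ∸ (rk (B ∪ T) ∸ rk T)) * ξ ^ ((r ∸ rk T) ∸ (rk (B ∪ T) ∸ rk T))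

  monomial : Subset n → Subset n → Carrier
  monomial A C = x ^ (∣ A ∣ ∸ rk A) * l ^ (r ∸ rk A) * y ^ (∣ C ∣ ∸ rk C) * ξ ^ (r ∸ rk C)

  convolutionTerm : Subset n → Carrier
  convolutionTerm T = weight T * Rpoly R (restrict M T) (- x) (- l) * Rpoly R (contract M T) y ξ

  rankTerm : Subset n → Carrier
  rankTerm A = (x * y) ^ (∣ A ∣ ∸ rk A) * (l * ξ) ^ (r ∸ rk A)

  signedMonomial : Subset n → Subset n → Carrier
  signedMonomial A C = sg A * monomial A C

  term-collapse : ∀ {A T C} → A ⊆ T → T ⊆ C →
    weight T * restrictTerm T A * contractTerm T (C ─ T) ≈ sg T * (sg A * monomial A C)
  term-collapse {A} {T} {C} A⊆T T⊆C = trans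
    (monomial-identity x y l ξ (rk-bound A) (rk-mono A⊆T) (rk-bound T)
      (rk-mono (q⊆p∪q (C ─ T) T)) (rk-mono ⊆⊤) (rk-∪-≤ (C ─ T) T))
    (reflexive (≡.cong₂ (λ k D → sg T * (sg A * (x ^ (∣ A ∣ ∸ rk A) * l ^ (r ∸ rk A)
                                                 * y ^ (k ∸ rk D) * ξ ^ (r ∸ rk D))))
                        (∣─∣+∣∣ C T T⊆C) (─-∪-cancel C T T⊆C)))

  summand-expansion : ∀ T →
    convolutionTerm T ≈ sumSub R T (λ A → sg T * sumSup T (signedMonomial A))
  summand-expansion T = begin
    weight T * sumSub R T (restrictTerm T) * sumSub R (∁ T) (contractTerm T)
      ≈⟨ *-congˡ (sumSub-complement T (contractTerm T)) ⟩
    weight T * sumSub R T (restrictTerm T) * sumSup T (λ C → contractTerm T (C ─ T))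
      ≈⟨ *-congʳ (sumWhere-*ˡ (_⊆? T) (weight T) (restrictTerm T)) ⟩
    sumSub R T (λ A → weight T * restrictTerm T A) * sumSup T (λ C → contractTerm T (C ─ T))
      ≈⟨ sumWhere-product (_⊆? T) (T ⊆?_) _ _ ⟩
    sumSub R T (λ A → sumSup T (λ C → weight T * restrictTerm T A * contractTerm T (C ─ T)))
      ≈⟨ sumWhere-cong (_⊆? T) (λ A A⊆T → sumWhere-cong (T ⊆?_) (λ C T⊆C → term-collapse A⊆T T⊆C)) ⟩
    sumSub R T (λ A → sumSup T (λ C → sg T * (sg A * monomial A C)))
      ≈⟨ sumWhere-cong (_⊆? T) (λ A _ → sym (sumWhere-*ˡ (T ⊆?_) (sg T) _)) ⟩
    sumSub R T (λ A → sg T * sumSup T (signedMonomial A)) ∎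

  diagonal : ∀ A → sg A * signedMonomial A A ≈ rankTerm A
  diagonal A = begin
    sg A * (sg A * (X * L * Y * Z))   ≈⟨ trans (sym (*-assoc _ _ _)) (sgn-sq-cancel ∣ A ∣ _) ⟩
    X * L * Y * Z                     ≈⟨ *-assoc (X * L) Y Z ⟩
    (X * L) * (Y * Z)                 ≈⟨ interchange X L Y Z ⟩
    (X * Y) * (L * Z)                 ≈⟨ sym (*-cong (^-distrib-* x y (∣ A ∣ ∸ rk A)) (^-distrib-* l ξ (r ∸ rk A))) ⟩
    (x * y) ^ (∣ A ∣ ∸ rk A) * (l * ξ) ^ (r ∸ rk A) ∎
    where
    X Y L Z : Carrier
    X = x ^ (∣ A ∣ ∸ rk A)
    Y = y ^ (∣ A ∣ ∸ rk A)
    L = l ^ (r ∸ rk A)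
    Z = ξ ^ (r ∸ rk A)

mainTheorem2 : ∀ {c ℓ : Level} (R : CommutativeRing c ℓ) {n : ℕ} (M : Matroid n)
    → let open CommutativeRing R in
      let rk = Matroid.rk M in
      let r = Matroid.rank M in
      ∀ (x y l ξ : Carrier) →
      Rpoly R (whole M) (x * y) (l * ξ)
        ≈ sumSub R ⊤ (λ T →
            pow R l (r ∸ rk T) * pow R (- y) (∣ T ∣ ∸ rk T)
              * Rpoly R (restrict M T) (- x) (- l)
              * Rpoly R (contract M T) y ξ)
mainTheorem2 R M x y l ξ = sym (begin
  sumSub R ⊤ convolutionTerm
    ≈⟨ sumWhere-all (_⊆? ⊤) convolutionTerm (λ _ → ⊆⊤) ⟩
  sumAll convolutionTerm
    ≈⟨ sumAll-cong summand-expansion ⟩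
  sumAll (λ T → sumSub R T (λ A → sg T * sumSup T (signedMonomial A)))
    ≈⟨ sumSub-sumSup-swap (λ A T → sg T * sumSup T (signedMonomial A)) ⟩
  sumAll (λ A → sumSup A (λ T → sg T * sumSup T (signedMonomial A)))
    ≈⟨ sumAll-cong (λ A → mobius A (signedMonomial A)) ⟩
  sumAll (λ A → sg A * signedMonomial A A)
    ≈⟨ sumAll-cong diagonal ⟩
  sumAll rankTerm
    ≈⟨ sym (sumWhere-all (_⊆? ⊤) rankTerm (λ _ → ⊆⊤)) ⟩
  sumSub R ⊤ rankTerm ∎)
  where
  open CommutativeRing R using (setoid; sym; _*_)
  open import Relation.Binary.Reasoning.Setoid setoid
  open OverRing R
  open Convolution R M x y l ξ
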